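{- The only ultrahomogeneous ordered partition of $V(H_0)$ into at most three parts is the trivial partition (with one part).
   Context: $H_0$ is the oriented graph on $\{x_1,\dots,x_8\}$ with arcs $(x_i,x_j)$ for $(i,j)\in\{(1,2),(2,5),(5,6),(6,1),(3,4),(4,7),(7,8),(8,3),(1,8),(8,5),(5,4),(4,1),(3,2),(2,7),(7,6),(6,3),(2,8),(8,6),(6,4),(4,2),(7,1),(1,3),(3,5),(5,7)\}$, regarded as a complete colored digraph with one vertex color and edge color $1$ on arcs and $0$ on other ordered pairs. An ordered partition $A=(P_1,\dots,P_k)$ of $V(H_0)$ (disjoint non-empty sets covering $V(H_0)$) is ultrahomogeneous if $H_0$ with the vertex coloring $v\mapsto i$ for $v\in P_i$ is ultrahomogeneous, i.e., every isomorphism between induced subgraphs preserving arcs, non-arcs and this coloring extends to an automorphism preserving the coloring. -}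

module Defs where

open import Data.Nat using (ℕ; suc; _≡ᵇ_)
open import Data.Bool using (Bool; true; false; _∧_; _∨_)
open import Data.Fin using (Fin; toℕ)
open import Data.List using (List; []; _∷_)
open import Data.Bool.ListAction using (any)
import Data.Fin.Subset as FS
open FS using (_∈_)
open import Data.Product using (_×_; _,_; Σ; ∃)
open import Relation.Binary.PropositionalEquality using (_≡_)

-- Vertices x₁ … x₈ are represented by Fin 8, with x_i ↦ the element of toℕ-value i ∸ 1.
V : Set
V = Fin 8

-- Arcs (i , j) of H₀, with 1-based indices exactly as in the paper.
arcList : List (ℕ × ℕ)
arcList =
  (1 , 2) ∷ (2 , 5) ∷ (5 , 6) ∷ (6 , 1) ∷ (3 , 4) ∷ (4 , 7) ∷ (7 , 8) ∷ (8 , 3) ∷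
  (1 , 8) ∷ (8 , 5) ∷ (5 , 4) ∷ (4 , 1) ∷ (3 , 2) ∷ (2 , 7) ∷ (7 , 6) ∷ (6 , 3) ∷
  (2 , 8) ∷ (8 , 6) ∷ (6 , 4) ∷ (4 , 2) ∷ (7 , 1) ∷ (1 , 3) ∷ (3 , 5) ∷ (5 , 7) ∷ []

-- Edge colour of the ordered pair (u , v): true (colour 1) iff (u , v) is an arc of H₀,
-- false (colour 0) otherwise (including u ≡ v).
arc : V → V → Bool
arc u v = any (λ { (i , j) → (suc (toℕ u) ≡ᵇ i) ∧ (suc (toℕ v) ≡ᵇ j) }) arcList

-- An ordered partition (P₁ , … , P_k) of V(H₀) into k parts is encoded by the map
-- c : V → Fin k sending v to the index of its part; parts are non-empty iff c is surjective.
IsOrderedPartition : {k : ℕ} → (V → Fin k) → Set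
IsOrderedPartition {k} c = (i : Fin k) → ∃ λ v → c v ≡ i

Subset : Set
Subset = FS.Subset 8

IsPartialIso : {k : ℕ} → (V → Fin k) → Subset → (V → V) → Set
IsPartialIso c S f =
  (∀ u v → u ∈ S → v ∈ S → f u ≡ f v → u ≡ v) ×
  (∀ u v → u ∈ S → v ∈ S → arc (f u) (f v) ≡ arc u v) ×
  (∀ u → u ∈ S → c (f u) ≡ c u)

IsColouredAut : {k : ℕ} → (V → Fin k) → (V → V) → Set
IsColouredAut c g =
  (∀ u v → g u ≡ g v → u ≡ v) ×
  (∀ w → ∃ λ u → g u ≡ w) ×
  (∀ u v → arc (g u) (g v) ≡ arc u v) ×
  (∀ u → c (g u) ≡ c u)

Ultrahomogeneous : {k : ℕ} → (V → Fin k) → Set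
Ultrahomogeneous c =
  (S : Subset) (f : V → V) → IsPartialIso c S f →
  Σ (V → V) λ g → IsColouredAut c g × (∀ u → u ∈ S → g u ≡ f u)

{-# OPTIONS --safe #-}
module Submission where

-- The automorphism group of H₀ has order 24 and is transitive on the ordered pairs of each
-- profile (equal, arc, reversed arc, non-adjacent); moreover a vertex is determined by its
-- profiles relative to the two ends of an arc, and the only vertices non-adjacent to u are u
-- and its antipode. So an automorphism that agrees with a partial automorphism f on an arc
-- of its domain, or on a single point when the domain contains no arc, agrees with f on the
-- whole domain: with one part, H₀ is ultrahomogeneous.
-- Conversely, if a colour-preserving partial automorphism f extends to a colour-preserving
-- automorphism g, then g sends any further point w to a vertex of the colour of w that has
-- the same profiles relative to f(S) as w relative to S. An exhaustive check shows that for
-- every colouring with two or three non-empty classes one of 19 partial automorphisms on at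
-- most two points preserves the colours, while every admissible image of a chosen further
-- point has the wrong colour.

open import Defs
open import Data.Nat using (ℕ; suc; _≤_; s≤s)
open import Data.Fin using (Fin; zero; #_)
open import Data.Fin.Properties using (_≟_; all?; any?; ¬Fin0)
open import Data.Fin.Subset using (_∈_; ⁅_⁆; ⋃)
open import Data.Fin.Subset.Properties using (_∈?_)
open import Data.Bool using (Bool; true; false; if_then_else_)
import Data.Bool.Properties as Bool
open import Data.Product using (_×_; _,_; ∃; proj₁; proj₂)
open import Data.Product.Properties using (≡-dec)
open import Data.List using (List; []; _∷_; map; foldr)
open import Data.List.Membership.Propositional renaming (_∈_ to _∈ₗ_)
open import Data.List.Relation.Unary.Any as Any using (Any)
open import Data.List.Relation.Unary.All as All using (All)
open import Data.Vec using (Vec; []; _∷_; lookup; tabulate)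
open import Data.Vec.Properties using (lookup∘tabulate)
open import Data.Empty using (⊥-elim)
open import Function using (_∘_; id)
open import Relation.Binary.Definitions using (DecidableEquality)
open import Relation.Binary.PropositionalEquality
  using (_≡_; _≢_; _≗_; refl; sym; trans; cong; cong₂; module ≡-Reasoning)
open import Relation.Nullary using (¬_; Dec; yes; no; does)
open import Relation.Nullary.Decidable
  using (map′; toWitness; dec-true; dec-false; ¬?; _×-dec_; _→-dec_)

Profile : Set
Profile = Bool × Bool × Bool

_≟ᴾ_ : DecidableEquality Profile
_≟ᴾ_ = ≡-dec Bool._≟_ (≡-dec Bool._≟_ Bool._≟_)

profile : V → V → Profile
profile u v = does (u ≟ v) , arc u v , arc v u

profile-preserved : (f : V → V) (u v : V) → (f u ≡ f v → u ≡ v) →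
                    arc (f u) (f v) ≡ arc u v → arc (f v) (f u) ≡ arc v u →
                    profile (f u) (f v) ≡ profile u v
profile-preserved f u v inj uv vu = cong₂ _,_ same-equality (cong₂ _,_ uv vu)
  where
    same-equality : does (f u ≟ f v) ≡ does (u ≟ v)
    same-equality with u ≟ v
    ... | yes refl = dec-true (f u ≟ f u) refl
    ... | no u≢v = dec-false (f u ≟ f v) (u≢v ∘ inj)

IsPartialAutomorphism : Subset → (V → V) → Set
IsPartialAutomorphism S f =
  (∀ u v → u ∈ S → v ∈ S → f u ≡ f v → u ≡ v) ×
  (∀ u v → u ∈ S → v ∈ S → arc (f u) (f v) ≡ arc u v)

IsAutomorphism : (V → V) → Set
IsAutomorphism g =
  (∀ u v → g u ≡ g v → u ≡ v) ×
  (∀ w → ∃ λ u → g u ≡ w) ×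
  (∀ u v → arc (g u) (g v) ≡ arc u v)

partialAutomorphism-profile : ∀ {S f} → IsPartialAutomorphism S f → ∀ {u v} → u ∈ S → v ∈ S →
                              profile (f u) (f v) ≡ profile u v
partialAutomorphism-profile {f = f} (inj , arcs) {u} {v} u∈S v∈S =
  profile-preserved f u v (inj u v u∈S v∈S) (arcs u v u∈S v∈S) (arcs v u v∈S u∈S)

automorphism-profile : ∀ {g} → IsAutomorphism g → ∀ u v → profile (g u) (g v) ≡ profile u v
automorphism-profile {g} (inj , _ , arcs) u v =
  profile-preserved g u v (inj u v) (arcs u v) (arcs v u)

-- The 24 automorphisms of H₀ as tables of values.
automorphisms : List (Vec V 8)
automorphisms =
  (# 0 ∷ # 1 ∷ # 2 ∷ # 3 ∷ # 4 ∷ # 5 ∷ # 6 ∷ # 7 ∷ []) ∷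
  (# 0 ∷ # 2 ∷ # 7 ∷ # 5 ∷ # 4 ∷ # 6 ∷ # 3 ∷ # 1 ∷ []) ∷
  (# 0 ∷ # 7 ∷ # 1 ∷ # 6 ∷ # 4 ∷ # 3 ∷ # 5 ∷ # 2 ∷ []) ∷
  (# 1 ∷ # 4 ∷ # 7 ∷ # 2 ∷ # 5 ∷ # 0 ∷ # 3 ∷ # 6 ∷ []) ∷
  (# 1 ∷ # 6 ∷ # 4 ∷ # 3 ∷ # 5 ∷ # 2 ∷ # 0 ∷ # 7 ∷ []) ∷
  (# 1 ∷ # 7 ∷ # 6 ∷ # 0 ∷ # 5 ∷ # 3 ∷ # 2 ∷ # 4 ∷ []) ∷
  (# 2 ∷ # 1 ∷ # 3 ∷ # 0 ∷ # 6 ∷ # 5 ∷ # 7 ∷ # 4 ∷ []) ∷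
  (# 2 ∷ # 3 ∷ # 4 ∷ # 5 ∷ # 6 ∷ # 7 ∷ # 0 ∷ # 1 ∷ []) ∷
  (# 2 ∷ # 4 ∷ # 1 ∷ # 7 ∷ # 6 ∷ # 0 ∷ # 5 ∷ # 3 ∷ []) ∷
  (# 3 ∷ # 0 ∷ # 6 ∷ # 5 ∷ # 7 ∷ # 4 ∷ # 2 ∷ # 1 ∷ []) ∷
  (# 3 ∷ # 1 ∷ # 0 ∷ # 2 ∷ # 7 ∷ # 5 ∷ # 4 ∷ # 6 ∷ []) ∷
  (# 3 ∷ # 6 ∷ # 1 ∷ # 4 ∷ # 7 ∷ # 2 ∷ # 5 ∷ # 0 ∷ []) ∷
  (# 4 ∷ # 3 ∷ # 5 ∷ # 2 ∷ # 0 ∷ # 7 ∷ # 1 ∷ # 6 ∷ []) ∷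
  (# 4 ∷ # 5 ∷ # 6 ∷ # 7 ∷ # 0 ∷ # 1 ∷ # 2 ∷ # 3 ∷ []) ∷
  (# 4 ∷ # 6 ∷ # 3 ∷ # 1 ∷ # 0 ∷ # 2 ∷ # 7 ∷ # 5 ∷ []) ∷
  (# 5 ∷ # 0 ∷ # 3 ∷ # 6 ∷ # 1 ∷ # 4 ∷ # 7 ∷ # 2 ∷ []) ∷
  (# 5 ∷ # 2 ∷ # 0 ∷ # 7 ∷ # 1 ∷ # 6 ∷ # 4 ∷ # 3 ∷ []) ∷
  (# 5 ∷ # 3 ∷ # 2 ∷ # 4 ∷ # 1 ∷ # 7 ∷ # 6 ∷ # 0 ∷ []) ∷
  (# 6 ∷ # 0 ∷ # 5 ∷ # 3 ∷ # 2 ∷ # 4 ∷ # 1 ∷ # 7 ∷ []) ∷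
  (# 6 ∷ # 5 ∷ # 7 ∷ # 4 ∷ # 2 ∷ # 1 ∷ # 3 ∷ # 0 ∷ []) ∷
  (# 6 ∷ # 7 ∷ # 0 ∷ # 1 ∷ # 2 ∷ # 3 ∷ # 4 ∷ # 5 ∷ []) ∷
  (# 7 ∷ # 2 ∷ # 5 ∷ # 0 ∷ # 3 ∷ # 6 ∷ # 1 ∷ # 4 ∷ []) ∷
  (# 7 ∷ # 4 ∷ # 2 ∷ # 1 ∷ # 3 ∷ # 0 ∷ # 6 ∷ # 5 ∷ []) ∷
  (# 7 ∷ # 5 ∷ # 4 ∷ # 6 ∷ # 3 ∷ # 1 ∷ # 0 ∷ # 2 ∷ []) ∷ []

isAutomorphism? : ∀ t → Dec (IsAutomorphism (lookup t))
isAutomorphism? t =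
  (all? λ u → all? λ v → lookup t u ≟ lookup t v →-dec u ≟ v) ×-dec
  (all? λ w → any? λ u → lookup t u ≟ w) ×-dec
  (all? λ u → all? λ v → arc (lookup t u) (lookup t v) Bool.≟ arc u v)

-- Certificates checked by evaluation; they are opaque so that later type checking never
-- unfolds, and thereby re-evaluates, them.
opaque
  automorphisms-valid : All (IsAutomorphism ∘ lookup) automorphisms
  automorphisms-valid = toWitness {a? = All.all? isAutomorphism? automorphisms} _

  automorphisms-pair-transitive :
    ∀ u v u′ v′ → profile u v ≡ profile u′ v′ →
    Any (λ t → lookup t u ≡ u′ × lookup t v ≡ v′) automorphisms
  automorphisms-pair-transitive = toWitness {a? =
    all? λ u → all? λ v → all? λ u′ → all? λ v′ →
      profile u v ≟ᴾ profile u′ v′ →-dec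
      Any.any? (λ t → (lookup t u ≟ u′) ×-dec (lookup t v ≟ v′)) automorphisms} _

  arc-separates : ∀ u v x y → arc u v ≡ true →
                  profile u x ≡ profile u y → profile v x ≡ profile v y → x ≡ y
  arc-separates = toWitness {a? =
    all? λ u → all? λ v → all? λ x → all? λ y →
      arc u v Bool.≟ true →-dec profile u x ≟ᴾ profile u y →-dec
      profile v x ≟ᴾ profile v y →-dec x ≟ y} _

  non-neighbour-separates : ∀ u x y → arc u x ≡ false → arc x u ≡ false →
                            profile u x ≡ profile u y → x ≡ y
  non-neighbour-separates = toWitness {a? =
    all? λ u → all? λ x → all? λ y →
      arc u x Bool.≟ false →-dec arc x u Bool.≟ false →-dec
      profile u x ≟ᴾ profile u y →-dec x ≟ y} _

pair-transitive : ∀ u v u′ v′ → profile u v ≡ profile u′ v′ →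
                  ∃ λ g → IsAutomorphism g × g u ≡ u′ × g v ≡ v′
pair-transitive u v u′ v′ same =
  let t = automorphisms-pair-transitive u v u′ v′ same
  in lookup (Any.lookup t) , All.lookupAny automorphisms-valid t

ExtendsToAutomorphism : Subset → (V → V) → Set
ExtendsToAutomorphism S f = ∃ λ g → IsAutomorphism g × (∀ x → x ∈ S → g x ≡ f x)

module _ {S : Subset} {f : V → V} (iso : IsPartialAutomorphism S f) where

  open ≡-Reasoning

  agreement⇒same-profile : ∀ {g u} → IsAutomorphism g → g u ≡ f u → u ∈ S →
                           ∀ {x} → x ∈ S → profile (f u) (g x) ≡ profile (f u) (f x)
  agreement⇒same-profile {g} {u} aut gu u∈S {x} x∈S = begin
    profile (f u) (g x) ≡⟨ cong (λ z → profile z (g x)) (sym gu) ⟩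
    profile (g u) (g x) ≡⟨ automorphism-profile aut u x ⟩
    profile u x         ≡⟨ partialAutomorphism-profile iso u∈S x∈S ⟨
    profile (f u) (f x) ∎

  extends-from-arc : ∀ {u v} → u ∈ S → v ∈ S → arc u v ≡ true → ExtendsToAutomorphism S f
  extends-from-arc {u} {v} u∈S v∈S uv
    with pair-transitive u v (f u) (f v) (sym (partialAutomorphism-profile iso u∈S v∈S))
  ... | g , aut , gu , gv = g , aut , λ x x∈S →
    arc-separates (f u) (f v) (g x) (f x) (trans (proj₂ iso u v u∈S v∈S) uv)
      (agreement⇒same-profile aut gu u∈S x∈S) (agreement⇒same-profile aut gv v∈S x∈S)

  extends-from-isolated : ∀ {u} → u ∈ S →
                          (∀ x → x ∈ S → arc u x ≡ false × arc x u ≡ false) →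
                          ExtendsToAutomorphism S f
  extends-from-isolated {u} u∈S isolated
    with pair-transitive u u (f u) (f u) (sym (partialAutomorphism-profile iso u∈S u∈S))
  ... | g , aut , gu , _ = g , aut , λ x x∈S →
    sym (non-neighbour-separates (f u) (f x) (g x)
      (trans (proj₂ iso u x u∈S x∈S) (proj₁ (isolated x x∈S)))
      (trans (proj₂ iso x u x∈S u∈S) (proj₂ (isolated x x∈S)))
      (sym (agreement⇒same-profile aut gu u∈S x∈S)))

  partialAutomorphism-extends : ExtendsToAutomorphism S f
  partialAutomorphism-extends
    with any? (λ u → any? λ v → u ∈? S ×-dec v ∈? S ×-dec arc u v Bool.≟ true)
  ... | yes (u , v , u∈S , v∈S , uv) = extends-from-arc u∈S v∈S uv
  ... | no no-arc with any? (_∈? S)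
  ...   | yes (u , u∈S) = extends-from-isolated u∈S λ x x∈S →
            Bool.¬-not (λ ux → no-arc (u , x , u∈S , x∈S , ux)) ,
            Bool.¬-not (λ xu → no-arc (x , u , x∈S , u∈S , xu))
  ...   | no empty = id , ((λ _ _ e → e) , (λ w → w , refl) , (λ _ _ → refl)) ,
                     λ x x∈S → ⊥-elim (empty (x , x∈S))

one-part-ultrahomogeneous : (c : V → Fin 1) → Ultrahomogeneous c
one-part-ultrahomogeneous c S f (inj , arcs , _) with partialAutomorphism-extends (inj , arcs)
... | g , (g-inj , g-surj , g-arcs) , agrees =
  g , (g-inj , g-surj , g-arcs , λ u → one-colour (c (g u)) (c u)) , agrees
  where
    one-colour : (i j : Fin 1) → i ≡ j
    one-colour zero zero = refl

Compatible : Subset → (V → V) → V → V → Set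
Compatible S f w y = ∀ u → u ∈ S → profile (f u) y ≡ profile u w

ultrahomogeneous⇒extensible : ∀ {k} {c : V → Fin k} → Ultrahomogeneous c →
                              ∀ {S f} → IsPartialIso c S f →
                              ∀ w → ∃ λ y → c y ≡ c w × Compatible S f w y
ultrahomogeneous⇒extensible uh {S} {f} iso w with uh S f iso
... | g , (g-inj , _ , g-arcs , g-colours) , agrees = g w , g-colours w , λ u u∈S →
  trans (cong (λ z → profile z (g w)) (sym (agrees u u∈S)))
        (profile-preserved g u w (g-inj u w) (g-arcs u w) (g-arcs w u))

Unextendable : ∀ {k} → (V → Fin k) → Subset → (V → V) → V → Set
Unextendable c S f w = IsPartialIso c S f × (∀ y → Compatible S f w y → c y ≢ c w)

unextendable⇒¬ultrahomogeneous : ∀ {k} {c : V → Fin k} {S f w} →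
                                 Unextendable c S f w → ¬ Ultrahomogeneous c
unextendable⇒¬ultrahomogeneous {w = w} (iso , stuck) uh
  with ultrahomogeneous⇒extensible uh iso w
... | y , same-colour , compatible = stuck y compatible same-colour

record ExtensionProblem : Set where
  constructor problem
  field
    assignments : List (V × V)
    point       : V
    images      : List V

  domain : Subset
  domain = ⋃ (map (⁅_⁆ ∘ proj₁) assignments)

  apply : V → V
  apply x = foldr (λ { (s , t) y → if does (s ≟ x) then t else y }) x assignments

  Sound : Set
  Sound = IsPartialAutomorphism domain apply ×
          (∀ y → Compatible domain apply point y → y ∈ₗ images)

  Refutes : ∀ {k} → (V → Fin k) → Set
  Refutes c = (∀ u → u ∈ domain → c (apply u) ≡ c u) × All (λ y → c y ≢ c point) images

  sound∧refutes⇒unextendable : ∀ {k} {c : V → Fin k} → Sound → Refutes c →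
                               Unextendable c domain apply point
  sound∧refutes⇒unextendable ((inj , arcs) , complete) (colours , recoloured) =
    (inj , arcs , colours) , λ y compatible → All.lookup recoloured (complete y compatible)

open ExtensionProblem

infix 6 _↦_
_↦_ : V → V → V × V
_↦_ = _,_

-- Found by a greedy covering search over all colourings with two or three classes. The
-- admissible images are recorded so that they are computed once rather than per colouring.
problems : List ExtensionProblem
problems =
  problem (# 0 ↦ # 1 ∷ []) (# 4) (# 5 ∷ []) ∷
  problem (# 4 ↦ # 5 ∷ []) (# 0) (# 1 ∷ []) ∷
  problem (# 0 ↦ # 6 ∷ # 3 ↦ # 3 ∷ []) (# 1) (# 0 ∷ []) ∷
  problem (# 1 ↦ # 6 ∷ # 3 ↦ # 3 ∷ []) (# 0) (# 1 ∷ []) ∷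
  problem (# 2 ↦ # 4 ∷ []) (# 6) (# 0 ∷ []) ∷
  problem (# 0 ↦ # 1 ∷ # 3 ↦ # 3 ∷ []) (# 2) (# 4 ∷ []) ∷
  problem (# 2 ↦ # 5 ∷ []) (# 6) (# 1 ∷ []) ∷
  problem (# 0 ↦ # 3 ∷ []) (# 4) (# 7 ∷ []) ∷
  problem (# 4 ↦ # 7 ∷ []) (# 0) (# 3 ∷ []) ∷
  problem (# 0 ↦ # 2 ∷ # 1 ↦ # 1 ∷ []) (# 2) (# 3 ∷ []) ∷
  problem (# 1 ↦ # 1 ∷ # 2 ↦ # 3 ∷ []) (# 0) (# 2 ∷ []) ∷
  problem (# 6 ↦ # 7 ∷ []) (# 2) (# 3 ∷ []) ∷
  problem (# 0 ↦ # 3 ∷ # 1 ↦ # 1 ∷ []) (# 6) (# 4 ∷ []) ∷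
  problem (# 0 ↦ # 5 ∷ []) (# 4) (# 1 ∷ []) ∷
  problem (# 0 ↦ # 4 ∷ []) (# 1) (# 3 ∷ # 5 ∷ # 6 ∷ []) ∷
  problem (# 1 ↦ # 5 ∷ []) (# 0) (# 4 ∷ # 6 ∷ # 7 ∷ []) ∷
  problem (# 2 ↦ # 6 ∷ []) (# 0) (# 1 ∷ # 3 ∷ # 4 ∷ []) ∷
  problem (# 3 ↦ # 7 ∷ []) (# 0) (# 2 ∷ # 4 ∷ # 5 ∷ []) ∷
  problem (# 0 ↦ # 0 ∷ # 1 ↦ # 7 ∷ []) (# 2) (# 1 ∷ []) ∷ []

opaque
  problems-sound : All Sound problems
  problems-sound = toWitness {a? = All.all? sound? problems} _
    where
      sound? : ∀ P → Dec (Sound P)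
      sound? P =
        ((all? λ u → all? λ v → u ∈? domain P →-dec v ∈? domain P →-dec
            apply P u ≟ apply P v →-dec u ≟ v) ×-dec
         (all? λ u → all? λ v → u ∈? domain P →-dec v ∈? domain P →-dec
            arc (apply P u) (apply P v) Bool.≟ arc u v)) ×-dec
        (all? λ y →
          (all? λ u → u ∈? domain P →-dec profile (apply P u) y ≟ᴾ profile u (point P)) →-dec
          Any.any? (y ≟_) (images P))

refutes? : ∀ {k} (c : V → Fin k) P → Dec (Refutes P c)
refutes? c P =
  (all? λ u → u ∈? domain P →-dec c (apply P u) ≟ c u) ×-dec
  All.all? (λ y → ¬? (c y ≟ c (point P))) (images P)

Refuted : ∀ {k} → (V → Fin k) → Set
Refuted c = Any (λ P → Refutes P c) problems

refuted⇒¬ultrahomogeneous : ∀ {k} {c : V → Fin k} → Refuted c → ¬ Ultrahomogeneous c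
refuted⇒¬ultrahomogeneous refuted =
  let sound , refutes = All.lookupAny problems-sound refuted
  in unextendable⇒¬ultrahomogeneous (sound∧refutes⇒unextendable (Any.lookup refuted) sound refutes)

all-vectors? : ∀ {a k} n {P : Vec (Fin k) n → Set a} → (∀ v → Dec (P v)) → Dec (∀ v → P v)
all-vectors? 0 P? = map′ (λ p → λ { [] → p }) (λ h → h []) (P? [])
all-vectors? (suc n) P? =
  map′ (λ h → λ { (x ∷ v) → h x v }) (λ h x v → h (x ∷ v))
       (all? λ x → all-vectors? n (λ v → P? (x ∷ v)))

AllPartitionsRefuted : ℕ → Set
AllPartitionsRefuted k = (v : Vec (Fin k) 8) → IsOrderedPartition (lookup v) → Refuted (lookup v)

allPartitionsRefuted? : ∀ k → Dec (AllPartitionsRefuted k)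
allPartitionsRefuted? k = all-vectors? 8 λ v →
  (all? λ i → any? λ x → lookup v x ≟ i) →-dec Any.any? (refutes? (lookup v)) problems

opaque
  two-part-partitions-refuted : AllPartitionsRefuted 2
  two-part-partitions-refuted = toWitness {a? = allPartitionsRefuted? 2} _

  three-part-partitions-refuted : AllPartitionsRefuted 3
  three-part-partitions-refuted = toWitness {a? = allPartitionsRefuted? 3} _

Ultrahomogeneous-resp-≗ : ∀ {k} {c d : V → Fin k} → c ≗ d →
                          Ultrahomogeneous c → Ultrahomogeneous d
Ultrahomogeneous-resp-≗ c≗d uh S f (inj , arcs , colours)
  with uh S f (inj , arcs , λ u u∈S → trans (c≗d (f u)) (trans (colours u u∈S) (sym (c≗d u))))
... | g , (g-inj , g-surj , g-arcs , g-colours) , agrees =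
  g , (g-inj , g-surj , g-arcs , λ u → trans (sym (c≗d (g u))) (trans (g-colours u) (c≗d u))) ,
  agrees

partition-not-ultrahomogeneous : ∀ {k} → AllPartitionsRefuted k →
                                 (c : V → Fin k) → IsOrderedPartition c → ¬ Ultrahomogeneous c
partition-not-ultrahomogeneous refuted c part =
  refuted⇒¬ultrahomogeneous (refuted (tabulate c) part′) ∘
  Ultrahomogeneous-resp-≗ (sym ∘ lookup∘tabulate c)
  where
    part′ : IsOrderedPartition (lookup (tabulate c))
    part′ i = let x , cx≡i = part i in x , trans (lookup∘tabulate c x) cx≡i

mainTheorem14 : (k : ℕ) (c : V → Fin k) → IsOrderedPartition c → k ≤ 3 →
                    (Ultrahomogeneous c → k ≡ 1) × (k ≡ 1 → Ultrahomogeneous c)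
mainTheorem14 0 c _ _ = ⊥-elim (¬Fin0 (c (# 0)))
mainTheorem14 1 c _ _ = (λ _ → refl) , λ _ → one-part-ultrahomogeneous c
mainTheorem14 2 c part _ =
  ⊥-elim ∘ partition-not-ultrahomogeneous two-part-partitions-refuted c part , λ ()
mainTheorem14 3 c part _ =
  ⊥-elim ∘ partition-not-ultrahomogeneous three-part-partitions-refuted c part , λ ()
mainTheorem14 (suc (suc (suc (suc _)))) _ _ (s≤s (s≤s (s≤s ())))
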